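{- For any pair $(n,k)$ of positive integers with $n\ge k$ and any prime $p$, each quantity $\frac{(2n)!}{\prod_{i=1}^{2n} i!^{c_i}c_i!}$ (for $\lambda\in\mathcal{P}'_{2n,2k}$) is an integer, and $$s(n,k)\equiv\sum_{\lambda\in \mathcal{P}'_{2n,2k}}\left[\frac{(2n)!}{\prod_{i=1}^{2n} i!^{c_i}c_i!}\right]_p \prod_{i=1}^{2n}\left[u\!\left(\tfrac{i-1}{2}\right)^{c_i}\right]_p \pmod p,$$ where $[x]_p$ is the residue class of the integer $x$ mod $p$ and $c_i$ is the number of parts of $\lambda$ equal to $i$.
   Context: Define integer sequences $u$ by $u(0)=1$ and, for $n\ge 1$, $u(n)=\Big(\prod_{j=1}^{n}(4j-1)\Big)^2-\sum_{m=0}^{n-1}\binom{2n+1}{2m+1}\Big(\prod_{j=1}^{n-m}(4j-3)\Big)^2u(m)$. For $1\le k\le n$ define $s(n,k)=\frac{(2n)!}{(2k)!}[z^{2n}]\Big(\sum_{j=0}^\infty \frac{u(j)}{(2j+1)!}z^{2j+1}\Big)^{2k}$, where $[z^m]f$ is the coefficient of $z^m$. $\mathcal{P}'_{N,K}$ is the set of unordered partitions of $N$ into $K$ parts, all parts odd. -}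

module Defs where

open import Data.Bool using (Bool; if_then_else_; _∧_)
open import Data.Nat as ℕ using (ℕ; zero; suc; _∸_; _≤ᵇ_; _≡ᵇ_; NonZero)
open import Data.Nat.Properties using (_!≢0; m*n≢0; m^n≢0)
open import Data.Nat.Combinatorics using (_C_)
open import Data.Nat.DivMod using (_/_; _%_)
open import Data.Integer as ℤ using (ℤ; +_)
open import Data.Rational as ℚ using (ℚ; 0ℚ; 1ℚ)
open import Data.List using (List; []; _∷_; [_]; _++_; map; concatMap; applyUpTo; length; filter; foldr)

prodℕ : ℕ → (ℕ → ℕ) → ℕ
prodℕ zero    f = 1
prodℕ (suc N) f = prodℕ N f ℕ.* f (suc N)

prodℤ : ℕ → (ℕ → ℤ) → ℤ
prodℤ zero    f = + 1
prodℤ (suc N) f = prodℤ N f ℤ.* f (suc N)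

sumBelowℤ : ℕ → (ℕ → ℤ) → ℤ
sumBelowℤ zero    f = + 0
sumBelowℤ (suc n) f = sumBelowℤ n f ℤ.+ f n

sumBelowℚ : ℕ → (ℕ → ℚ) → ℚ
sumBelowℚ zero    f = 0ℚ
sumBelowℚ (suc n) f = sumBelowℚ n f ℚ.+ f n

sumListℤ : List ℤ → ℤ
sumListℤ = foldr ℤ._+_ (+ 0)

prod4m1 : ℕ → ℕ
prod4m1 n = prodℕ n (λ j → 4 ℕ.* j ∸ 1)

prod4m3 : ℕ → ℕ
prod4m3 n = prodℕ n (λ j → 4 ℕ.* j ∸ 3)

nth : List ℤ → ℕ → ℤ
nth []       _       = + 0
nth (x ∷ xs) zero    = x
nth (x ∷ xs) (suc m) = nth xs m

-- u(n) computed from the list vs = [u(0), ..., u(n-1)]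
uStep : ℕ → List ℤ → ℤ
uStep n vs =
  (+ (prod4m1 n ℕ.^ 2)) ℤ.-
  sumBelowℤ n (λ m → + (((2 ℕ.* n ℕ.+ 1) C (2 ℕ.* m ℕ.+ 1)) ℕ.* (prod4m3 (n ∸ m) ℕ.^ 2))
                      ℤ.* nth vs m)

uTab : ℕ → List ℤ
uTab zero    = + 1 ∷ []
uTab (suc n) = uTab n ++ [ uStep (suc n) (uTab n) ]

u : ℕ → ℤ
u n = nth (uTab n) n

-- s(n,k) = (2n)!/(2k)! [z^{2n}] F(z)^{2k},  F(z) = Σ_j u(j) z^{2j+1}/(2j+1)!

coeffF : ℕ → ℚ
coeffF d = if d % 2 ≡ᵇ 1 then (u (d / 2) ℚ./ (d ℕ.!)) {{d !≢0}} else 0ℚ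

-- coefficient of z^d in (Σ a_i z^i)^e  (iterated Cauchy product)
powCoeff : (ℕ → ℚ) → ℕ → ℕ → ℚ
powCoeff a zero    d = if d ≡ᵇ 0 then 1ℚ else 0ℚ
powCoeff a (suc e) d = sumBelowℚ (suc d) (λ i → a i ℚ.* powCoeff a e (d ∸ i))

s : ℕ → ℕ → ℚ
s n k = ((+ ((2 ℕ.* n) ℕ.!)) ℚ./ ((2 ℕ.* k) ℕ.!)) {{(2 ℕ.* k) !≢0}}
        ℚ.* powCoeff coeffF (2 ℕ.* k) (2 ℕ.* n)

-- nonincreasing lists of exactly K odd parts, each part ≤ m, summing to N
oddPartsBounded : ℕ → ℕ → ℕ → List (List ℕ)
oddPartsBounded zero    zero    m = [ [] ]
oddPartsBounded (suc N) zero    m = []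
oddPartsBounded N       (suc K) m =
  concatMap (λ i → if (i ≤ᵇ N) ∧ (i % 2 ≡ᵇ 1)
                   then map (i ∷_) (oddPartsBounded (N ∸ i) K i)
                   else [])
            (applyUpTo suc m)

-- 𝒫'_{N,K}: each unordered partition is listed once, as a nonincreasing list
P' : ℕ → ℕ → List (List ℕ)
P' N K = oddPartsBounded N K N

mult : List ℕ → ℕ → ℕ
mult ps i = length (filter (ℕ._≟ i) ps)

denom : ℕ → List ℕ → ℕ
denom N ps = prodℕ N (λ i → (i ℕ.!) ℕ.^ mult ps i ℕ.* (mult ps i) ℕ.!)

denom≢0 : ∀ N ps → NonZero (denom N ps)
denom≢0 zero    ps = _
denom≢0 (suc N) ps =
  m*n≢0 (denom N ps) _ {{denom≢0 N ps}}
    {{m*n≢0 _ _ {{m^n≢0 _ (mult ps (suc N)) {{suc N !≢0}}}} {{mult ps (suc N) !≢0}}}}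

-- N! / ∏_{i=1}^{N} i!^{c_i} c_i!   (floor division; exact by the theorem)
multinom : ℕ → List ℕ → ℕ
multinom N ps = ((N ℕ.!) / denom N ps) {{denom≢0 N ps}}

uProd : ℕ → List ℕ → ℤ
uProd N ps = prodℤ N (λ i → u ((i ∸ 1) / 2) ℤ.^ mult ps i)

term : ℕ → List ℕ → ℤ
term N ps = (+ multinom N ps) ℤ.* uProd N ps

-- Put aᵢ = u((i−1)/2)/i! for odd i and aᵢ = 0 for even i, so that F(z) = Σᵢ aᵢ zⁱ and
-- exp (t F(z)) = ∏ᵢ exp (t aᵢ zⁱ).  Comparing coefficients of tᴷ zᴺ gives
-- [zᴺ] Fᴷ / K! = Σ_λ ∏ᵢ aᵢ^cᵢ / cᵢ! over the partitions λ of N into K parts, of which only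
-- those into odd parts contribute; the comparison is proved by induction on the largest
-- admissible part, through the identity obtained by differentiating in t.  Multiplied by N!,
-- the summand of λ is N! / ∏ᵢ i!^cᵢ cᵢ! · ∏ᵢ u((i−1)/2)^cᵢ, so s(n,k) equals the sum of
-- the integer summands exactly, and the congruence holds for every p.  The summands are
-- integers because (m!)^c c! ∣ (cm)! and a! b! ∣ (a+b)!.

module Submission where

open import Defs
open import Data.Nat using (ℕ; _≤_; _*_; _!)
open import Data.Nat.Divisibility using (_∣_)
open import Data.Nat.Primality using (Prime)
open import Data.Integer as ℤ using (ℤ; +_; _-_)
open import Data.Integer.Divisibility as ℤD using ()
open import Data.Rational using (ℚ; _/_)
open import Data.List using (List; map)
open import Data.List.Membership.Propositional using (_∈_)
open import Data.Product using (_×_; ∃-syntax)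
open import Relation.Binary.PropositionalEquality using (_≡_)

open import Algebra.Bundles using (CommutativeRing)
open import Data.Bool using (Bool; true; false; if_then_else_; _∧_; T)
open import Data.Empty using (⊥-elim)
open import Data.List using ([]; _∷_; [_]; _++_; concat; concatMap; applyUpTo)
open import Data.List.Relation.Unary.All as All using (All; []; _∷_)
import Data.List.Relation.Unary.All.Properties as All
import Data.List.Properties as List
open import Data.Nat as ℕ using (zero; suc; NonZero; _∸_; _<_; _≤ᵇ_; _≡ᵇ_; z≤n; s≤s; _+_)
open import Data.Nat.Combinatorics using (k![n∸k]!∣n!)
open import Data.Nat.DivMod using (_%_; m≡m%n+[m/n]*n; m*n/n≡m; m/n*n≡m)
import Data.Nat.DivMod as ℕ
import Data.Nat.Divisibility as ℕ
open import Data.Nat.ListAction using (sum)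
import Data.Nat.Properties as ℕ
open import Data.Nat.Properties using (_!≢0)
import Data.Nat.Tactic.RingSolver as ℕ-Solver
import Data.Integer.Properties as ℤ
import Data.Integer.Tactic.RingSolver as ℤ-Solver
open import Data.Product using (_,_; proj₂)
open import Data.Rational as ℚ using (0ℚ; 1ℚ)
import Data.Rational.Properties as ℚ
open import Data.Rational.Solver using (module +-*-Solver)
import Data.Rational.Unnormalised as ℚᵘ
import Data.Rational.Unnormalised.Properties as ℚᵘ
open import Data.Unit using (tt)
open import Relation.Binary.PropositionalEquality
  using (refl; sym; trans; cong; cong₂; subst; _≢_; module ≡-Reasoning)
open import Relation.Nullary using (yes; no)

open +-*-Solver using (solve; _:=_; _:+_; _:*_)
open import Algebra.Properties.CommutativeSemiring.Exp
  (CommutativeRing.commutativeSemiring ℚ.+-*-commutativeRing) using (_^_; ^-distrib-*)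

fromℤ : ℤ → ℚ
fromℤ a = a / 1

fromℕ : ℕ → ℚ
fromℕ n = fromℤ (+ n)

infix 9 1/ℕ_
1/ℕ_ : (d : ℕ) → .{{NonZero d}} → ℚ
1/ℕ d = + 1 / d

cross-mul⇒/-≡ : ∀ (a b : ℤ) (c d : ℕ) .{{_ : NonZero c}} .{{_ : NonZero d}} →
                a ℤ.* + d ≡ b ℤ.* + c → a / c ≡ b / d
cross-mul⇒/-≡ a b (suc c) (suc d) eq =
  ℚ.fromℚᵘ-cong {ℚᵘ.mkℚᵘ a c} {ℚᵘ.mkℚᵘ b d} (ℚᵘ.*≡* eq)

/-+-/ : ∀ (a b : ℤ) (c d : ℕ) .{{_ : NonZero c}} .{{_ : NonZero d}} →
        (a / c) ℚ.+ (b / d) ≡ ((a ℤ.* + d ℤ.+ b ℤ.* + c) / (c ℕ.* d)) {{ℕ.m*n≢0 c d}}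
/-+-/ a b (suc c) (suc d) = ℚ.toℚᵘ-injective (ℚᵘ.≃-trans (ℚ.toℚᵘ-homo-+ (a / suc c) (b / suc d))
  (ℚᵘ.≃-trans (ℚᵘ.+-cong (ℚ.toℚᵘ-fromℚᵘ (ℚᵘ.mkℚᵘ a c)) (ℚ.toℚᵘ-fromℚᵘ (ℚᵘ.mkℚᵘ b d)))
    (ℚᵘ.≃-sym (ℚ.toℚᵘ-fromℚᵘ _))))

/-*-/ : ∀ (a b : ℤ) (c d : ℕ) .{{_ : NonZero c}} .{{_ : NonZero d}} →
        (a / c) ℚ.* (b / d) ≡ ((a ℤ.* b) / (c ℕ.* d)) {{ℕ.m*n≢0 c d}}
/-*-/ a b (suc c) (suc d) = ℚ.toℚᵘ-injective (ℚᵘ.≃-trans (ℚ.toℚᵘ-homo-* (a / suc c) (b / suc d))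
  (ℚᵘ.≃-trans (ℚᵘ.*-cong (ℚ.toℚᵘ-fromℚᵘ (ℚᵘ.mkℚᵘ a c)) (ℚ.toℚᵘ-fromℚᵘ (ℚᵘ.mkℚᵘ b d)))
    (ℚᵘ.≃-sym (ℚ.toℚᵘ-fromℚᵘ _))))

fromℤ-+ : ∀ a b → fromℤ (a ℤ.+ b) ≡ fromℤ a ℚ.+ fromℤ b
fromℤ-+ a b = trans (cross-mul⇒/-≡ (a ℤ.+ b) (a ℤ.* + 1 ℤ.+ b ℤ.* + 1) 1 1 (cross a b)) (sym (/-+-/ a b 1 1))
  where
  cross : ∀ a b → (a ℤ.+ b) ℤ.* + 1 ≡ (a ℤ.* + 1 ℤ.+ b ℤ.* + 1) ℤ.* + 1
  cross = ℤ-Solver.solve-∀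

fromℤ-* : ∀ a b → fromℤ (a ℤ.* b) ≡ fromℤ a ℚ.* fromℤ b
fromℤ-* a b = sym (/-*-/ a b 1 1)

fromℕ-+ : ∀ m n → fromℕ (m + n) ≡ fromℕ m ℚ.+ fromℕ n
fromℕ-+ m n = fromℤ-+ (+ m) (+ n)

fromℕ-* : ∀ m n → fromℕ (m ℕ.* n) ≡ fromℕ m ℚ.* fromℕ n
fromℕ-* m n = trans (cong fromℤ (ℤ.pos-* m n)) (fromℤ-* (+ m) (+ n))

/≡fromℤ*1/ℕ : ∀ a d .{{_ : NonZero d}} → a / d ≡ fromℤ a ℚ.* 1/ℕ d
/≡fromℤ*1/ℕ a d@(suc _) =
  trans (cross-mul⇒/-≡ a (a ℤ.* + 1) d (1 ℕ.* d) (cross a (+ d))) (sym (/-*-/ a (+ 1) 1 d))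
  where
  cross : ∀ a d → a ℤ.* (+ 1 ℤ.* d) ≡ (a ℤ.* + 1) ℤ.* d
  cross = ℤ-Solver.solve-∀

1/ℕ-* : ∀ c d .{{_ : NonZero c}} .{{_ : NonZero d}} →
        (1/ℕ (c ℕ.* d)) {{ℕ.m*n≢0 c d}} ≡ 1/ℕ c ℚ.* 1/ℕ d
1/ℕ-* c@(suc _) d@(suc _) = sym (/-*-/ (+ 1) (+ 1) c d)

fromℕ*1/ℕ≡1 : ∀ d .{{_ : NonZero d}} → fromℕ d ℚ.* 1/ℕ d ≡ 1ℚ
fromℕ*1/ℕ≡1 d@(suc _) =
  trans (/-*-/ (+ d) (+ 1) 1 d) (cross-mul⇒/-≡ (+ d ℤ.* + 1) (+ 1) (1 ℕ.* d) 1 (cross (+ d)))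
  where
  cross : ∀ d → (d ℤ.* + 1) ℤ.* + 1 ≡ + 1 ℤ.* (+ 1 ℤ.* d)
  cross = ℤ-Solver.solve-∀

fromℕ-/ : ∀ n d .{{_ : NonZero d}} → d ∣ n → fromℕ (n ℕ./ d) ≡ fromℕ n ℚ.* 1/ℕ d
fromℕ-/ n d d∣n = begin
  fromℕ (n ℕ./ d)                             ≡⟨ ℚ.*-identityʳ _ ⟨
  fromℕ (n ℕ./ d) ℚ.* 1ℚ                      ≡⟨ cong (fromℕ (n ℕ./ d) ℚ.*_) (fromℕ*1/ℕ≡1 d) ⟨
  fromℕ (n ℕ./ d) ℚ.* (fromℕ d ℚ.* 1/ℕ d)     ≡⟨ ℚ.*-assoc (fromℕ (n ℕ./ d)) _ _ ⟨
  fromℕ (n ℕ./ d) ℚ.* fromℕ d ℚ.* 1/ℕ d       ≡⟨ cong (ℚ._* 1/ℕ d) (fromℕ-* (n ℕ./ d) d) ⟨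
  fromℕ (n ℕ./ d ℕ.* d) ℚ.* 1/ℕ d             ≡⟨ cong (λ k → fromℕ k ℚ.* 1/ℕ d) (m/n*n≡m d∣n) ⟩
  fromℕ n ℚ.* 1/ℕ d                           ∎
  where open ≡-Reasoning

Σ< : ℕ → (ℕ → ℚ) → ℚ
Σ< = sumBelowℚ

infix 6.5 Σ<
syntax Σ< n (λ i → e) = Σ[ i < n ] e

Σ-cong : ∀ n {f g : ℕ → ℚ} → (∀ i → i < n → f i ≡ g i) → Σ< n f ≡ Σ< n g
Σ-cong zero    eq = refl
Σ-cong (suc n) eq = cong₂ ℚ._+_ (Σ-cong n (λ i i<n → eq i (ℕ.m≤n⇒m≤1+n i<n))) (eq n ℕ.≤-refl)

Σ-zero : ∀ n → Σ[ i < n ] 0ℚ ≡ 0ℚ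
Σ-zero zero    = refl
Σ-zero (suc n) = trans (ℚ.+-identityʳ _) (Σ-zero n)

Σ-+ : ∀ n f g → Σ[ i < n ] (f i ℚ.+ g i) ≡ Σ< n f ℚ.+ Σ< n g
Σ-+ zero    f g = refl
Σ-+ (suc n) f g = trans (cong (ℚ._+ (f n ℚ.+ g n)) (Σ-+ n f g)) (swap (Σ< n f) (Σ< n g) (f n) (g n))
  where
  swap : ∀ a b c d → (a ℚ.+ b) ℚ.+ (c ℚ.+ d) ≡ (a ℚ.+ c) ℚ.+ (b ℚ.+ d)
  swap = solve 4 (λ a b c d → (a :+ b) :+ (c :+ d) := (a :+ c) :+ (b :+ d)) refl

*-distribˡ-Σ : ∀ n c f → c ℚ.* Σ< n f ≡ Σ[ i < n ] (c ℚ.* f i)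
*-distribˡ-Σ zero    c f = ℚ.*-zeroʳ c
*-distribˡ-Σ (suc n) c f =
  trans (ℚ.*-distribˡ-+ c (Σ< n f) (f n)) (cong (ℚ._+ (c ℚ.* f n)) (*-distribˡ-Σ n c f))

*-distribʳ-Σ : ∀ n c f → Σ< n f ℚ.* c ≡ Σ[ i < n ] (f i ℚ.* c)
*-distribʳ-Σ n c f = trans (ℚ.*-comm (Σ< n f) c)
  (trans (*-distribˡ-Σ n c f) (Σ-cong n (λ i _ → ℚ.*-comm c (f i))))

Σ-suc : ∀ n f → Σ< (suc n) f ≡ f 0 ℚ.+ Σ[ i < n ] f (suc i)
Σ-suc zero    f = trans (ℚ.+-identityˡ (f 0)) (sym (ℚ.+-identityʳ (f 0)))
Σ-suc (suc n) f = trans (cong (ℚ._+ f (suc n)) (Σ-suc n f)) (ℚ.+-assoc (f 0) _ _)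

Σ-comm : ∀ m n (f : ℕ → ℕ → ℚ) → Σ[ i < m ] Σ< n (f i) ≡ Σ[ j < n ] Σ[ i < m ] f i j
Σ-comm zero    n f = sym (Σ-zero n)
Σ-comm (suc m) n f =
  trans (cong (ℚ._+ Σ< n (f m)) (Σ-comm m n f)) (sym (Σ-+ n (λ j → Σ[ i < m ] f i j) (f m)))

prodℚ : ℕ → (ℕ → ℚ) → ℚ
prodℚ zero    f = 1ℚ
prodℚ (suc B) f = prodℚ B f ℚ.* f (suc B)

prodℚ-cong : ∀ B {f g : ℕ → ℚ} → (∀ i → i ≤ B → f i ≡ g i) → prodℚ B f ≡ prodℚ B g
prodℚ-cong zero    eq = refl
prodℚ-cong (suc B) eq =
  cong₂ ℚ._*_ (prodℚ-cong B (λ i i≤B → eq i (ℕ.m≤n⇒m≤1+n i≤B))) (eq (suc B) ℕ.≤-refl)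

prodℚ-one : ∀ B → prodℚ B (λ _ → 1ℚ) ≡ 1ℚ
prodℚ-one zero    = refl
prodℚ-one (suc B) = trans (ℚ.*-identityʳ _) (prodℚ-one B)

prodℚ-* : ∀ B f g → prodℚ B f ℚ.* prodℚ B g ≡ prodℚ B (λ i → f i ℚ.* g i)
prodℚ-* zero    f g = refl
prodℚ-* (suc B) f g =
  trans (interchange (prodℚ B f) (f (suc B)) (prodℚ B g) (g (suc B)))
        (cong (ℚ._* (f (suc B) ℚ.* g (suc B))) (prodℚ-* B f g))
  where
  interchange : ∀ a b c d → (a ℚ.* b) ℚ.* (c ℚ.* d) ≡ (a ℚ.* c) ℚ.* (b ℚ.* d)
  interchange = solve 4 (λ a b c d → (a :* b) :* (c :* d) := (a :* c) :* (b :* d)) refl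

prodℚ-update : ∀ B i {f g : ℕ → ℚ} e → 1 ≤ i → i ≤ B →
               (∀ j → j ≢ i → f j ≡ g j) → f i ≡ g i ℚ.* e → prodℚ B f ≡ prodℚ B g ℚ.* e
prodℚ-update zero    i e 1≤i i≤0 _ _ = ⊥-elim (ℕ.<⇒≱ 1≤i i≤0)
prodℚ-update (suc B) i {f} {g} e 1≤i i≤B off at with i ℕ.≟ suc B
... | yes refl = trans (cong₂ ℚ._*_ (prodℚ-cong B (λ j j≤B → off j (ℕ.<⇒≢ (s≤s j≤B)))) at)
                       (sym (ℚ.*-assoc (prodℚ B g) (g i) e))
... | no i≢1+B = trans (cong₂ ℚ._*_ (prodℚ-update B i e 1≤i (ℕ.≤-pred (ℕ.≤∧≢⇒< i≤B i≢1+B)) off at)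
                                    (off (suc B) (λ eq → i≢1+B (sym eq))))
                       (swap (prodℚ B g) e (g (suc B)))
  where
  swap : ∀ a b c → a ℚ.* b ℚ.* c ≡ a ℚ.* c ℚ.* b
  swap = solve 3 (λ a b c → a :* b :* c := a :* c :* b) refl

prodℕ≢0 : ∀ B g → (∀ i → NonZero (g i)) → NonZero (prodℕ B g)
prodℕ≢0 zero    g g≢0 = _
prodℕ≢0 (suc B) g g≢0 = ℕ.m*n≢0 _ _ {{prodℕ≢0 B g g≢0}} {{g≢0 (suc B)}}

fromℤ-prodℤ : ∀ B f → fromℤ (prodℤ B f) ≡ prodℚ B (λ i → fromℤ (f i))
fromℤ-prodℤ zero    f = refl
fromℤ-prodℤ (suc B) f =
  trans (fromℤ-* (prodℤ B f) (f (suc B))) (cong (ℚ._* fromℤ (f (suc B))) (fromℤ-prodℤ B f))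

1/ℕ-prodℕ : ∀ B g (g≢0 : ∀ i → NonZero (g i)) →
            (1/ℕ prodℕ B g) {{prodℕ≢0 B g g≢0}} ≡ prodℚ B (λ i → (1/ℕ g i) {{g≢0 i}})
1/ℕ-prodℕ zero    g g≢0 = refl
1/ℕ-prodℕ (suc B) g g≢0 =
  trans (1/ℕ-* (prodℕ B g) (g (suc B)) {{prodℕ≢0 B g g≢0}} {{g≢0 (suc B)}})
        (cong (ℚ._* (1/ℕ g (suc B)) {{g≢0 (suc B)}}) (1/ℕ-prodℕ B g g≢0))

fromℤ-^ : ∀ x n → fromℤ (x ℤ.^ n) ≡ fromℤ x ^ n
fromℤ-^ x zero    = refl
fromℤ-^ x (suc n) = trans (fromℤ-* x (x ℤ.^ n)) (cong (fromℤ x ℚ.*_) (fromℤ-^ x n))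

1/ℕ-^ : ∀ d n .{{_ : NonZero d}} → (1/ℕ (d ℕ.^ n)) {{ℕ.m^n≢0 d n}} ≡ (1/ℕ d) ^ n
1/ℕ-^ d zero    = refl
1/ℕ-^ d (suc n) {{d≢0}} =
  trans (1/ℕ-* d (d ℕ.^ n) {{d≢0}} {{ℕ.m^n≢0 d n {{d≢0}}}}) (cong (1/ℕ d ℚ.*_) (1/ℕ-^ d n))

-- shift d N f is the coefficient of z^N in z^d · Σₙ f n zⁿ.
shift : ℕ → ℕ → (ℕ → ℚ) → ℚ
shift d N f = if d ≤ᵇ N then f (N ∸ d) else 0ℚ

≤ᵇ≡true⇒≤ : ∀ {a b} → (a ≤ᵇ b) ≡ true → a ≤ b
≤ᵇ≡true⇒≤ {a} {b} eq = ℕ.≤ᵇ⇒≤ a b (subst T (sym eq) tt)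

≤ᵇ≡false⇒> : ∀ {a b} → (a ≤ᵇ b) ≡ false → b < a
≤ᵇ≡false⇒> {a} {b} eq = ℕ.≰⇒> (λ a≤b → subst T eq (ℕ.≤⇒≤ᵇ a≤b))

>⇒≤ᵇ≡false : ∀ {a b} → b < a → (a ≤ᵇ b) ≡ false
>⇒≤ᵇ≡false {a} {b} b<a with a ≤ᵇ b in eq
... | true  = ⊥-elim (ℕ.<⇒≱ b<a (≤ᵇ≡true⇒≤ eq))
... | false = refl

shift-cong : ∀ d N {f g : ℕ → ℚ} → (∀ n → f n ≡ g n) → shift d N f ≡ shift d N g
shift-cong d N eq with d ≤ᵇ N
... | true  = eq _
... | false = refl

*-shift : ∀ c d N f → c ℚ.* shift d N f ≡ shift d N (λ n → c ℚ.* f n)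
*-shift c d N f with d ≤ᵇ N
... | true  = refl
... | false = ℚ.*-zeroʳ c

shift-≤ : ∀ {d N} f → d ≤ N → shift d N f ≡ f (N ∸ d)
shift-≤ {d} {N} f d≤N with d ≤ᵇ N in eq
... | true  = refl
... | false = ⊥-elim (ℕ.<⇒≱ (≤ᵇ≡false⇒> eq) d≤N)

shift-shift : ∀ d e N f → shift d N (λ n → shift e n f) ≡ shift (d + e) N f
shift-shift d e N f with d ≤ᵇ N in d≤ᵇN | d + e ≤ᵇ N in d+e≤ᵇN
... | true  | true  = trans (shift-≤ f e≤N∸d) (cong f (ℕ.∸-+-assoc N d e))
  where
  e≤N∸d : e ≤ N ∸ d
  e≤N∸d = subst (_≤ N ∸ d) (ℕ.m+n∸m≡n d e) (ℕ.∸-monoˡ-≤ d (≤ᵇ≡true⇒≤ d+e≤ᵇN))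
... | true  | false with e ≤ᵇ (N ∸ d) in e≤ᵇN∸d
...   | true  = ⊥-elim (ℕ.<⇒≱ (≤ᵇ≡false⇒> d+e≤ᵇN)
                  (subst (d + e ≤_) (ℕ.m+[n∸m]≡n {d} {N} (≤ᵇ≡true⇒≤ d≤ᵇN)) (ℕ.+-monoʳ-≤ d (≤ᵇ≡true⇒≤ e≤ᵇN∸d))))
...   | false = refl
shift-shift d e N f | false | true  =
  ⊥-elim (ℕ.<⇒≱ (≤ᵇ≡false⇒> d≤ᵇN) (ℕ.≤-trans (ℕ.m≤m+n d e) (≤ᵇ≡true⇒≤ d+e≤ᵇN)))
shift-shift d e N f | false | false = refl

shift-Σ : ∀ d N n (f : ℕ → ℕ → ℚ) → shift d N (λ k → Σ< n (f k)) ≡ Σ[ i < n ] shift d N (λ k → f k i)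
shift-Σ d N n f with d ≤ᵇ N
... | true  = refl
... | false = sym (Σ-zero n)

Σ∈ : List (List ℕ) → (List ℕ → ℚ) → ℚ
Σ∈ []         g = 0ℚ
Σ∈ (ps ∷ pss) g = g ps ℚ.+ Σ∈ pss g

Σ∈-++ : ∀ pss qss g → Σ∈ (pss ++ qss) g ≡ Σ∈ pss g ℚ.+ Σ∈ qss g
Σ∈-++ []         qss g = sym (ℚ.+-identityˡ _)
Σ∈-++ (ps ∷ pss) qss g = trans (cong (g ps ℚ.+_) (Σ∈-++ pss qss g)) (sym (ℚ.+-assoc (g ps) _ _))

Σ∈-map-∷ : ∀ i pss g → Σ∈ (map (i ∷_) pss) g ≡ Σ∈ pss (λ ps → g (i ∷ ps))
Σ∈-map-∷ i []         g = refl
Σ∈-map-∷ i (ps ∷ pss) g = cong (g (i ∷ ps) ℚ.+_) (Σ∈-map-∷ i pss g)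

Σ∈-cong : ∀ {pss} {g h : List ℕ → ℚ} → All (λ ps → g ps ≡ h ps) pss → Σ∈ pss g ≡ Σ∈ pss h
Σ∈-cong []         = refl
Σ∈-cong (eq ∷ eqs) = cong₂ ℚ._+_ eq (Σ∈-cong eqs)

*-distribˡ-Σ∈ : ∀ pss c g → c ℚ.* Σ∈ pss g ≡ Σ∈ pss (λ ps → c ℚ.* g ps)
*-distribˡ-Σ∈ []         c g = ℚ.*-zeroʳ c
*-distribˡ-Σ∈ (ps ∷ pss) c g =
  trans (ℚ.*-distribˡ-+ c (g ps) _) (cong (c ℚ.* g ps ℚ.+_) (*-distribˡ-Σ∈ pss c g))

fromℤ-sumListℤ : ∀ (f : List ℕ → ℤ) pss → fromℤ (sumListℤ (map f pss)) ≡ Σ∈ pss (λ ps → fromℤ (f ps))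
fromℤ-sumListℤ f []         = refl
fromℤ-sumListℤ f (ps ∷ pss) = trans (fromℤ-+ (f ps) _) (cong (fromℤ (f ps) ℚ.+_) (fromℤ-sumListℤ f pss))

fits : ℕ → ℕ → Bool
fits i N = (i ≤ᵇ N) ∧ (i % 2 ≡ᵇ 1)

concatMap-upTo-suc : ∀ {B : Set} (F : ℕ → List B) m →
                     concatMap F (applyUpTo suc (suc m)) ≡ concatMap F (applyUpTo suc m) ++ F (suc m)
concatMap-upTo-suc F m = begin
  concatMap F (applyUpTo suc (suc m))  ≡⟨ cong (concatMap F) (List.applyUpTo-∷ʳ suc m) ⟨
  concat (map F (xs ++ [ suc m ]))     ≡⟨ cong concat (List.map-++ F xs [ suc m ]) ⟩
  concat (map F xs ++ [ F (suc m) ])   ≡⟨ List.concat-++ (map F xs) [ F (suc m) ] ⟨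
  concatMap F xs ++ (F (suc m) ++ [])  ≡⟨ cong (concatMap F xs ++_) (List.++-identityʳ (F (suc m))) ⟩
  concatMap F xs ++ F (suc m)          ∎
  where
  open ≡-Reasoning
  xs = applyUpTo suc m

oddPartsBounded-suc : ∀ N K m → oddPartsBounded N (suc K) (suc m) ≡
  oddPartsBounded N (suc K) m ++
  (if fits (suc m) N then map (suc m ∷_) (oddPartsBounded (N ∸ suc m) K (suc m)) else [])
oddPartsBounded-suc zero    K m = concatMap-upTo-suc _ m
oddPartsBounded-suc (suc N) K m = concatMap-upTo-suc _ m

oddPartsBounded-zero : ∀ N K → oddPartsBounded N (suc K) 0 ≡ []
oddPartsBounded-zero zero    K = refl
oddPartsBounded-zero (suc N) K = refl

OddPart : ℕ → ℕ → Set
OddPart m x = 1 ≤ x × x ≤ m × (x % 2 ≡ᵇ 1) ≡ true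

IsOddPartition : ℕ → ℕ → List ℕ → Set
IsOddPartition N m ps = sum ps ≡ N × All (OddPart m) ps

oddPartsBounded-sound : ∀ K N m → All (IsOddPartition N m) (oddPartsBounded N K m)
oddPartsBounded-sound zero    zero    m = (refl , []) ∷ []
oddPartsBounded-sound zero    (suc N) m = []
oddPartsBounded-sound (suc K) N zero
  rewrite oddPartsBounded-zero N K = []
oddPartsBounded-sound (suc K) N (suc m)
  rewrite oddPartsBounded-suc N K m =
  All.++⁺ (All.map weaken (oddPartsBounded-sound (suc K) N m)) largest
  where
  weaken : ∀ {ps} → IsOddPartition N m ps → IsOddPartition N (suc m) ps
  weaken (Σps≡N , odd) = Σps≡N , All.map (λ (1≤x , x≤m , x-odd) → 1≤x , ℕ.m≤n⇒m≤1+n x≤m , x-odd) odd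
  largest : All (IsOddPartition N (suc m))
    (if fits (suc m) N then map (suc m ∷_) (oddPartsBounded (N ∸ suc m) K (suc m)) else [])
  largest with suc m ≤ᵇ N in 1+m≤ᵇN | suc m % 2 ≡ᵇ 1 in 1+m-odd
  ... | false | _     = []
  ... | true  | false = []
  ... | true  | true  = All.map⁺ (All.map extend (oddPartsBounded-sound K (N ∸ suc m) (suc m)))
    where
    extend : ∀ {ps} → IsOddPartition (N ∸ suc m) (suc m) ps → IsOddPartition N (suc m) (suc m ∷ ps)
    extend (Σps≡N∸1+m , odd) =
      trans (cong (λ s → suc m + s) Σps≡N∸1+m) (ℕ.m+[n∸m]≡n (≤ᵇ≡true⇒≤ 1+m≤ᵇN)) ,
      (s≤s z≤n , ℕ.≤-refl , 1+m-odd) ∷ odd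

partSum : ℕ → ℕ → ℕ → (List ℕ → ℚ) → ℚ
partSum N K m g = Σ∈ (oddPartsBounded N K m) g

partSum-cong : ∀ N K m {g h : List ℕ → ℚ} →
               (∀ ps → IsOddPartition N m ps → g ps ≡ h ps) → partSum N K m g ≡ partSum N K m h
partSum-cong N K m eq = Σ∈-cong (All.map (λ {ps} → eq ps) (oddPartsBounded-sound K N m))

*-distribˡ-partSum : ∀ N K m c g → c ℚ.* partSum N K m g ≡ partSum N K m (λ ps → c ℚ.* g ps)
*-distribˡ-partSum N K m = *-distribˡ-Σ∈ (oddPartsBounded N K m)

partSum-suc : ∀ N K m g → partSum N (suc K) (suc m) g ≡ partSum N (suc K) m g ℚ.+
  (if fits (suc m) N then partSum (N ∸ suc m) K (suc m) (λ ps → g (suc m ∷ ps)) else 0ℚ)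
partSum-suc N K m g = begin
  partSum N (suc K) (suc m) g
    ≡⟨ cong (λ pss → Σ∈ pss g) (oddPartsBounded-suc N K m) ⟩
  Σ∈ (oddPartsBounded N (suc K) m ++ largest) g
    ≡⟨ Σ∈-++ (oddPartsBounded N (suc K) m) largest g ⟩
  partSum N (suc K) m g ℚ.+ Σ∈ largest g
    ≡⟨ cong (partSum N (suc K) m g ℚ.+_) (Σ∈-largest (fits (suc m) N)) ⟩
  partSum N (suc K) m g ℚ.+
  (if fits (suc m) N then partSum (N ∸ suc m) K (suc m) (λ ps → g (suc m ∷ ps)) else 0ℚ) ∎
  where
  open ≡-Reasoning
  largest = if fits (suc m) N then map (suc m ∷_) (oddPartsBounded (N ∸ suc m) K (suc m)) else []
  Σ∈-largest : ∀ b →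
    Σ∈ (if b then map (suc m ∷_) (oddPartsBounded (N ∸ suc m) K (suc m)) else []) g ≡
    (if b then partSum (N ∸ suc m) K (suc m) (λ ps → g (suc m ∷ ps)) else 0ℚ)
  Σ∈-largest true  = Σ∈-map-∷ (suc m) (oddPartsBounded (N ∸ suc m) K (suc m)) g
  Σ∈-largest false = refl

partSum-zero-bound : ∀ N K g → partSum N (suc K) 0 g ≡ 0ℚ
partSum-zero-bound N K g = cong (λ pss → Σ∈ pss g) (oddPartsBounded-zero N K)

partSum-odd : ∀ N K m g → (suc m % 2 ≡ᵇ 1) ≡ true →
              partSum N (suc K) (suc m) g ≡
              partSum N (suc K) m g ℚ.+ shift (suc m) N (λ N′ → partSum N′ K (suc m) (λ ps → g (suc m ∷ ps)))
partSum-odd N K m g odd rewrite partSum-suc N K m g | odd with suc m ≤ᵇ N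
... | true  = refl
... | false = refl

partSum-even : ∀ N K m g → (suc m % 2 ≡ᵇ 1) ≡ false → partSum N K (suc m) g ≡ partSum N K m g
partSum-even zero    zero    m g even = refl
partSum-even (suc N) zero    m g even = refl
partSum-even N       (suc K) m g even rewrite partSum-suc N K m g | even with suc m ≤ᵇ N
... | true  = ℚ.+-identityʳ _
... | false = ℚ.+-identityʳ _

partSum-beyond : ∀ N K m g → N ≤ m → partSum N K (suc m) g ≡ partSum N K m g
partSum-beyond zero    zero     m g _   = refl
partSum-beyond (suc N) zero     m g _   = refl
partSum-beyond N       (suc K) m g N≤m
  rewrite partSum-suc N K m g | >⇒≤ᵇ≡false (s≤s N≤m) = ℚ.+-identityʳ _

partSum-bound : ∀ N K m g → N ≤ m → partSum N K m g ≡ partSum N K N g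
partSum-bound N K m g N≤m = trans (cong (λ b → partSum N K b g) (sym (ℕ.m∸n+n≡m N≤m))) (lower (m ∸ N))
  where
  lower : ∀ d → partSum N K (d + N) g ≡ partSum N K N g
  lower zero    = refl
  lower (suc d) = trans (partSum-beyond N K (d + N) g (ℕ.m≤n+m N d)) (lower d)

expCoeff : ℚ → ℕ → ℚ
expCoeff y j = y ^ j ℚ.* (1/ℕ (j !)) {{j !≢0}}

expCoeff-suc : ∀ y j → expCoeff y (suc j) ≡ expCoeff y j ℚ.* (y ℚ.* 1/ℕ (suc j))
expCoeff-suc y j = begin
  (y ℚ.* y ^ j) ℚ.* (1/ℕ (suc j ℕ.* j !)) {{suc j !≢0}}
    ≡⟨ cong ((y ℚ.* y ^ j) ℚ.*_) (1/ℕ-* (suc j) (j !) {{_}} {{j !≢0}}) ⟩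
  (y ℚ.* y ^ j) ℚ.* (1/ℕ (suc j) ℚ.* (1/ℕ (j !)) {{j !≢0}})
    ≡⟨ regroup y (y ^ j) (1/ℕ (suc j)) ((1/ℕ (j !)) {{j !≢0}}) ⟩
  expCoeff y j ℚ.* (y ℚ.* 1/ℕ (suc j)) ∎
  where
  open ≡-Reasoning
  regroup : ∀ y p s f → (y ℚ.* p) ℚ.* (s ℚ.* f) ≡ (p ℚ.* f) ℚ.* (y ℚ.* s)
  regroup = solve 4 (λ y p s f → (y :* p) :* (s :* f) := (p :* f) :* (y :* s)) refl

suc*expCoeff-suc : ∀ y j → fromℕ (suc j) ℚ.* expCoeff y (suc j) ≡ y ℚ.* expCoeff y j
suc*expCoeff-suc y j = begin
  fromℕ (suc j) ℚ.* expCoeff y (suc j)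
    ≡⟨ cong (fromℕ (suc j) ℚ.*_) (expCoeff-suc y j) ⟩
  fromℕ (suc j) ℚ.* (expCoeff y j ℚ.* (y ℚ.* 1/ℕ (suc j)))
    ≡⟨ regroup (fromℕ (suc j)) (expCoeff y j) y (1/ℕ (suc j)) ⟩
  (fromℕ (suc j) ℚ.* 1/ℕ (suc j)) ℚ.* (y ℚ.* expCoeff y j)
    ≡⟨ trans (cong (ℚ._* (y ℚ.* expCoeff y j)) (fromℕ*1/ℕ≡1 (suc j))) (ℚ.*-identityˡ _) ⟩
  y ℚ.* expCoeff y j ∎
  where
  open ≡-Reasoning
  regroup : ∀ n e y s → n ℚ.* (e ℚ.* (y ℚ.* s)) ≡ (n ℚ.* s) ℚ.* (y ℚ.* e)
  regroup = solve 4 (λ n e y s → n :* (e :* (y :* s)) := (n :* s) :* (y :* e)) refl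

mult-∷-≡ : ∀ i ps → mult (i ∷ ps) i ≡ suc (mult ps i)
mult-∷-≡ i ps with i ≡ᵇ i in eq
... | true  = refl
... | false = ⊥-elim (subst T eq (ℕ.≡⇒≡ᵇ i i refl))

mult-∷-≢ : ∀ {j i} ps → j ≢ i → mult (j ∷ ps) i ≡ mult ps i
mult-∷-≢ {j} {i} ps j≢i with j ≡ᵇ i in eq
... | true  = ⊥-elim (j≢i (ℕ.≡ᵇ⇒≡ j i (subst T (sym eq) tt)))
... | false = refl

mult-above : ∀ {m} ps → All (OddPart m) ps → mult ps (suc m) ≡ 0
mult-above []       []                      = refl
mult-above (x ∷ ps) ((_ , x≤m , _) ∷ odd) =
  trans (mult-∷-≢ ps (ℕ.<⇒≢ (s≤s x≤m))) (mult-above ps odd)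

weight : (ℕ → ℚ) → ℕ → List ℕ → ℚ
weight a B ps = prodℚ B (λ i → expCoeff (a i) (mult ps i))

weight-[] : ∀ a B → weight a B [] ≡ 1ℚ
weight-[] a B = prodℚ-one B

weight-∷ : ∀ a B i ps → 1 ≤ i → i ≤ B →
           weight a B (i ∷ ps) ≡ weight a B ps ℚ.* (a i ℚ.* 1/ℕ suc (mult ps i))
weight-∷ a B i ps 1≤i i≤B = prodℚ-update B i _ 1≤i i≤B
  (λ j j≢i → cong (expCoeff (a j)) (mult-∷-≢ ps (λ i≡j → j≢i (sym i≡j))))
  (trans (cong (expCoeff (a i)) (mult-∷-≡ i ps)) (expCoeff-suc (a i) (mult ps i)))

-- Tail-recursive, so that copies M (suc j) ps and copies M j (M ∷ ps) agree definitionally.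
copies : ℕ → ℕ → List ℕ → List ℕ
copies M zero    ps = ps
copies M (suc j) ps = copies M j (M ∷ ps)

copies-∷ : ∀ M j ps → copies M j (M ∷ ps) ≡ M ∷ copies M j ps
copies-∷ M zero    ps = refl
copies-∷ M (suc j) ps = copies-∷ M j (M ∷ ps)

mult-copies : ∀ M j ps → mult (copies M j ps) M ≡ j + mult ps M
mult-copies M zero    ps = refl
mult-copies M (suc j) ps =
  trans (mult-copies M j (M ∷ ps)) (trans (cong (j ℕ.+_) (mult-∷-≡ M ps)) (ℕ.+-suc j _))

weight-copies : ∀ a B M j ps → 1 ≤ M → M ≤ B → mult ps M ≡ 0 →
                weight a B (copies M j ps) ≡ expCoeff (a M) j ℚ.* weight a B ps
weight-copies a B M zero    ps _   _   _       = sym (ℚ.*-identityˡ _)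
weight-copies a B M (suc j) ps 1≤M M≤B noM = begin
  weight a B (copies M j (M ∷ ps))
    ≡⟨ cong (weight a B) (copies-∷ M j ps) ⟩
  weight a B (M ∷ copies M j ps)
    ≡⟨ weight-∷ a B M (copies M j ps) 1≤M M≤B ⟩
  weight a B (copies M j ps) ℚ.* (a M ℚ.* 1/ℕ suc (mult (copies M j ps) M))
    ≡⟨ cong₂ (λ w c → w ℚ.* (a M ℚ.* 1/ℕ suc c)) (weight-copies a B M j ps 1≤M M≤B noM)
             (trans (mult-copies M j ps) (trans (cong (j ℕ.+_) noM) (ℕ.+-identityʳ j))) ⟩
  (expCoeff (a M) j ℚ.* weight a B ps) ℚ.* (a M ℚ.* 1/ℕ suc j)
    ≡⟨ regroup (expCoeff (a M) j) (weight a B ps) (a M ℚ.* 1/ℕ suc j) ⟩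
  (expCoeff (a M) j ℚ.* (a M ℚ.* 1/ℕ suc j)) ℚ.* weight a B ps
    ≡⟨ cong (ℚ._* weight a B ps) (expCoeff-suc (a M) j) ⟨
  expCoeff (a M) (suc j) ℚ.* weight a B ps ∎
  where
  open ≡-Reasoning
  regroup : ∀ e w f → (e ℚ.* w) ℚ.* f ≡ (e ℚ.* f) ℚ.* w
  regroup = solve 3 (λ e w f → (e :* w) :* f := (e :* f) :* w) refl

module OddSeries (a : ℕ → ℚ) (a-even : ∀ i → (i % 2 ≡ᵇ 1) ≡ false → a i ≡ 0ℚ) (B : ℕ) where

  -- The coefficient of tᴷ zᴺ in ∏_{i ≤ m} exp (t aᵢ zⁱ).
  weightSum : ℕ → ℕ → ℕ → ℚ
  weightSum N K m = partSum N K m (weight a B)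

  -- ∂ₜ E = (Σᵢ aᵢ zⁱ) E at tᴷ zᴺ, for E = ∏_{i ≤ m} exp (t aᵢ zⁱ).
  Derivative : ℕ → Set
  Derivative m = ∀ K N → fromℕ (suc K) ℚ.* weightSum N (suc K) m ≡
                         Σ[ i < suc m ] a i ℚ.* shift i N (λ N′ → weightSum N′ K m)

  -- The factor exp (t a_M z^M) of the largest part contributes (a_M t z^M)ʲ / j! for j copies of M.
  module LargestPart (m : ℕ) (M≤B : suc m ≤ B) (odd : (suc m % 2 ≡ᵇ 1) ≡ true) where

    M = suc m
    E = expCoeff (a M)

    Wm : ℕ → ℕ → ℚ
    Wm k N′ = weightSum N′ k m

    partSum-by-multiplicity : ∀ K j N →
      partSum N K M (λ ps → weight a B (copies M j ps)) ≡
      Σ[ t < suc K ] shift (t ℕ.* M) N (λ N′ → E (j + t) ℚ.* Wm (K ∸ t) N′)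
    partSum-by-multiplicity zero j zero = begin
      weight a B (copies M j []) ℚ.+ 0ℚ
        ≡⟨ ℚ.+-identityʳ _ ⟩
      weight a B (copies M j [])
        ≡⟨ weight-copies a B M j [] (s≤s z≤n) M≤B refl ⟩
      E j ℚ.* weight a B []
        ≡⟨ cong₂ (λ i w → E i ℚ.* w) (sym (ℕ.+-identityʳ j)) (sym (ℚ.+-identityʳ _)) ⟩
      E (j + 0) ℚ.* (weight a B [] ℚ.+ 0ℚ)
        ≡⟨ ℚ.+-identityˡ _ ⟨
      0ℚ ℚ.+ E (j + 0) ℚ.* (weight a B [] ℚ.+ 0ℚ) ∎
      where open ≡-Reasoning
    partSum-by-multiplicity zero j (suc N) =
      sym (trans (ℚ.+-identityˡ _) (ℚ.*-zeroʳ (E (j + 0))))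
    partSum-by-multiplicity (suc K) j N = begin
      partSum N (suc K) M g
        ≡⟨ partSum-odd N K m g odd ⟩
      partSum N (suc K) m g ℚ.+ shift M N (λ N′ → partSum N′ K M (λ ps → weight a B (copies M (suc j) ps)))
        ≡⟨ cong₂ ℚ._+_ noLargest (shift-cong M N (λ N′ → partSum-by-multiplicity K (suc j) N′)) ⟩
      E (j + 0) ℚ.* Wm (suc K) N ℚ.+
        shift M N (λ N′ → Σ[ t < suc K ] shift (t ℕ.* M) N′ (λ N″ → E (suc j + t) ℚ.* Wm (K ∸ t) N″))
        ≡⟨ cong (E (j + 0) ℚ.* Wm (suc K) N ℚ.+_) largest ⟩
      E (j + 0) ℚ.* Wm (suc K) N ℚ.+
        Σ[ t < suc K ] shift (suc t ℕ.* M) N (λ N′ → E (j + suc t) ℚ.* Wm (suc K ∸ suc t) N′)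
        ≡⟨ Σ-suc (suc K) _ ⟨
      Σ[ t < suc (suc K) ] shift (t ℕ.* M) N (λ N′ → E (j + t) ℚ.* Wm (suc K ∸ t) N′) ∎
      where
      open ≡-Reasoning
      g : List ℕ → ℚ
      g ps = weight a B (copies M j ps)
      noLargest : partSum N (suc K) m g ≡ E (j + 0) ℚ.* Wm (suc K) N
      noLargest = begin
        partSum N (suc K) m g
          ≡⟨ partSum-cong N (suc K) m (λ ps (_ , odd) → weight-copies a B M j ps (s≤s z≤n) M≤B (mult-above ps odd)) ⟩
        partSum N (suc K) m (λ ps → E j ℚ.* weight a B ps)
          ≡⟨ *-distribˡ-partSum N (suc K) m (E j) (weight a B) ⟨
        E j ℚ.* Wm (suc K) N
          ≡⟨ cong (λ i → E i ℚ.* Wm (suc K) N) (ℕ.+-identityʳ j) ⟨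
        E (j + 0) ℚ.* Wm (suc K) N ∎
      largest :
        shift M N (λ N′ → Σ[ t < suc K ] shift (t ℕ.* M) N′ (λ N″ → E (suc j + t) ℚ.* Wm (K ∸ t) N″)) ≡
        Σ[ t < suc K ] shift (suc t ℕ.* M) N (λ N′ → E (j + suc t) ℚ.* Wm (suc K ∸ suc t) N′)
      largest = trans (shift-Σ M N (suc K) (λ N′ t → shift (t ℕ.* M) N′ (step t))) (Σ-cong (suc K) (λ t _ →
        trans (shift-shift M (t ℕ.* M) N (step t))
              (shift-cong (suc t ℕ.* M) N (λ N′ →
                 cong (λ i → E i ℚ.* Wm (K ∸ t) N′) (sym (ℕ.+-suc j t))))))
        where
        step : ℕ → ℕ → ℚ
        step t N″ = E (suc j + t) ℚ.* Wm (K ∸ t) N″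

    weightSum-by-multiplicity : ∀ K N → weightSum N K M ≡
      Σ[ t < suc K ] shift (t ℕ.* M) N (λ N′ → E t ℚ.* Wm (K ∸ t) N′)
    weightSum-by-multiplicity K N = partSum-by-multiplicity K 0 N

    module DerivativeStep (IH : Derivative m) (K N : ℕ) where

      y = a M

      WM : ℕ → ℕ → ℚ
      WM k N′ = weightSum N′ k M

      scaled : ℕ → ℕ → ℕ → ℚ
      scaled t k N′ = E t ℚ.* Wm k N′

      layer : ℕ → ℕ → ℕ → ℚ
      layer t k N′ = shift (t ℕ.* M) N′ (scaled t (k ∸ t))

      cross : ℕ → ℕ → ℚ
      cross t i = (a i ℚ.* E t) ℚ.* shift (i + t ℕ.* M) N (Wm (K ∸ t))

      lowered : ∀ t → t ≤ K → fromℕ (suc K ∸ t) ℚ.* layer t (suc K) N ≡ Σ[ i < suc m ] cross t i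
      lowered t t≤K = begin
        fromℕ (suc K ∸ t) ℚ.* layer t (suc K) N
          ≡⟨ cong (λ j → fromℕ j ℚ.* shift (t ℕ.* M) N (scaled t j)) (ℕ.+-∸-assoc 1 t≤K) ⟩
        fromℕ (suc k) ℚ.* shift (t ℕ.* M) N (scaled t (suc k))
          ≡⟨ *-shift (fromℕ (suc k)) (t ℕ.* M) N (scaled t (suc k)) ⟩
        shift (t ℕ.* M) N (λ N′ → fromℕ (suc k) ℚ.* scaled t (suc k) N′)
          ≡⟨ shift-cong (t ℕ.* M) N derive ⟩
        shift (t ℕ.* M) N (λ N′ → Σ[ i < suc m ] (a i ℚ.* E t) ℚ.* shift i N′ (Wm k))
          ≡⟨ shift-Σ (t ℕ.* M) N (suc m) (λ N′ i → (a i ℚ.* E t) ℚ.* shift i N′ (Wm k)) ⟩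
        Σ[ i < suc m ] shift (t ℕ.* M) N (λ N′ → (a i ℚ.* E t) ℚ.* shift i N′ (Wm k))
          ≡⟨ Σ-cong (suc m) (λ i _ → combine i) ⟩
        Σ[ i < suc m ] cross t i ∎
        where
        open ≡-Reasoning
        k = K ∸ t
        derive : ∀ N′ → fromℕ (suc k) ℚ.* scaled t (suc k) N′ ≡
                        Σ[ i < suc m ] (a i ℚ.* E t) ℚ.* shift i N′ (Wm k)
        derive N′ = begin
          fromℕ (suc k) ℚ.* (E t ℚ.* Wm (suc k) N′)
            ≡⟨ swap (fromℕ (suc k)) (E t) (Wm (suc k) N′) ⟩
          E t ℚ.* (fromℕ (suc k) ℚ.* Wm (suc k) N′)
            ≡⟨ cong (E t ℚ.*_) (IH k N′) ⟩
          E t ℚ.* (Σ[ i < suc m ] a i ℚ.* shift i N′ (Wm k))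
            ≡⟨ *-distribˡ-Σ (suc m) (E t) (λ i → a i ℚ.* shift i N′ (Wm k)) ⟩
          Σ[ i < suc m ] E t ℚ.* (a i ℚ.* shift i N′ (Wm k))
            ≡⟨ Σ-cong (suc m) (λ i _ → swap-assoc (E t) (a i) (shift i N′ (Wm k))) ⟩
          Σ[ i < suc m ] (a i ℚ.* E t) ℚ.* shift i N′ (Wm k) ∎
          where
          swap : ∀ n e w → n ℚ.* (e ℚ.* w) ≡ e ℚ.* (n ℚ.* w)
          swap = solve 3 (λ n e w → n :* (e :* w) := e :* (n :* w)) refl
          swap-assoc : ∀ e x s → e ℚ.* (x ℚ.* s) ≡ (x ℚ.* e) ℚ.* s
          swap-assoc = solve 3 (λ e x s → e :* (x :* s) := (x :* e) :* s) refl
        combine : ∀ i → shift (t ℕ.* M) N (λ N′ → (a i ℚ.* E t) ℚ.* shift i N′ (Wm k)) ≡ cross t i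
        combine i = begin
          shift (t ℕ.* M) N (λ N′ → (a i ℚ.* E t) ℚ.* shift i N′ (Wm k))
            ≡⟨ *-shift (a i ℚ.* E t) (t ℕ.* M) N (λ N′ → shift i N′ (Wm k)) ⟨
          (a i ℚ.* E t) ℚ.* shift (t ℕ.* M) N (λ N′ → shift i N′ (Wm k))
            ≡⟨ cong ((a i ℚ.* E t) ℚ.*_) (shift-shift (t ℕ.* M) i N (Wm k)) ⟩
          (a i ℚ.* E t) ℚ.* shift (t ℕ.* M + i) N (Wm k)
            ≡⟨ cong (λ d → (a i ℚ.* E t) ℚ.* shift d N (Wm k)) (ℕ.+-comm (t ℕ.* M) i) ⟩
          cross t i ∎

      raised : ∀ t → fromℕ (suc t) ℚ.* layer (suc t) (suc K) N ≡ y ℚ.* shift M N (layer t K)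
      raised t = begin
        fromℕ (suc t) ℚ.* shift (M + t ℕ.* M) N (scaled (suc t) (K ∸ t))
          ≡⟨ *-shift (fromℕ (suc t)) (M + t ℕ.* M) N (scaled (suc t) (K ∸ t)) ⟩
        shift (M + t ℕ.* M) N (λ N′ → fromℕ (suc t) ℚ.* scaled (suc t) (K ∸ t) N′)
          ≡⟨ shift-cong (M + t ℕ.* M) N lower ⟩
        shift (M + t ℕ.* M) N (λ N′ → y ℚ.* scaled t (K ∸ t) N′)
          ≡⟨ *-shift y (M + t ℕ.* M) N (scaled t (K ∸ t)) ⟨
        y ℚ.* shift (M + t ℕ.* M) N (scaled t (K ∸ t))
          ≡⟨ cong (y ℚ.*_) (shift-shift M (t ℕ.* M) N (scaled t (K ∸ t))) ⟨
        y ℚ.* shift M N (layer t K) ∎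
        where
        open ≡-Reasoning
        lower : ∀ N′ → fromℕ (suc t) ℚ.* scaled (suc t) (K ∸ t) N′ ≡ y ℚ.* scaled t (K ∸ t) N′
        lower N′ = begin
          fromℕ (suc t) ℚ.* (E (suc t) ℚ.* Wm (K ∸ t) N′)
            ≡⟨ ℚ.*-assoc (fromℕ (suc t)) (E (suc t)) (Wm (K ∸ t) N′) ⟨
          (fromℕ (suc t) ℚ.* E (suc t)) ℚ.* Wm (K ∸ t) N′
            ≡⟨ cong (ℚ._* Wm (K ∸ t) N′) (suc*expCoeff-suc y t) ⟩
          (y ℚ.* E t) ℚ.* Wm (K ∸ t) N′
            ≡⟨ ℚ.*-assoc y (E t) (Wm (K ∸ t) N′) ⟩
          y ℚ.* (E t ℚ.* Wm (K ∸ t) N′) ∎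

      expand : Σ[ i < suc M ] a i ℚ.* shift i N (WM K) ≡
               Σ[ t < suc K ] (Σ[ i < suc m ] cross t i) ℚ.+ Σ[ t < suc K ] y ℚ.* shift M N (layer t K)
      expand = cong₂ ℚ._+_
        (trans (Σ-cong (suc m) (λ i _ → smaller i)) (Σ-comm (suc m) (suc K) (λ i t → cross t i)))
        (trans (cong (y ℚ.*_) (expandShift M)) (*-distribˡ-Σ (suc K) y (λ t → shift M N (layer t K))))
        where
        open ≡-Reasoning
        expandShift : ∀ i → shift i N (WM K) ≡ Σ[ t < suc K ] shift i N (layer t K)
        expandShift i = trans (shift-cong i N (weightSum-by-multiplicity K))
                              (shift-Σ i N (suc K) (λ N′ t → layer t K N′))
        smaller : ∀ i → a i ℚ.* shift i N (WM K) ≡ Σ[ t < suc K ] cross t i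
        smaller i = begin
          a i ℚ.* shift i N (WM K)
            ≡⟨ cong (a i ℚ.*_) (expandShift i) ⟩
          a i ℚ.* (Σ[ t < suc K ] shift i N (layer t K))
            ≡⟨ *-distribˡ-Σ (suc K) (a i) (λ t → shift i N (layer t K)) ⟩
          Σ[ t < suc K ] a i ℚ.* shift i N (layer t K)
            ≡⟨ Σ-cong (suc K) (λ t _ → combine t) ⟩
          Σ[ t < suc K ] cross t i ∎
          where
          combine : ∀ t → a i ℚ.* shift i N (layer t K) ≡ cross t i
          combine t = begin
            a i ℚ.* shift i N (layer t K)
              ≡⟨ cong (a i ℚ.*_) (shift-shift i (t ℕ.* M) N (scaled t (K ∸ t))) ⟩
            a i ℚ.* shift (i + t ℕ.* M) N (scaled t (K ∸ t))
              ≡⟨ cong (a i ℚ.*_) (*-shift (E t) (i + t ℕ.* M) N (Wm (K ∸ t))) ⟨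
            a i ℚ.* (E t ℚ.* shift (i + t ℕ.* M) N (Wm (K ∸ t)))
              ≡⟨ ℚ.*-assoc (a i) (E t) (shift (i + t ℕ.* M) N (Wm (K ∸ t))) ⟨
            cross t i ∎

      -- The factor 1 + K is split as (1 + K − t) + t on the t-th layer: the first part is
      -- absorbed by the induction hypothesis, the second by t · E t = y · E (t − 1).
      derivative : fromℕ (suc K) ℚ.* weightSum N (suc K) M ≡ Σ[ i < suc M ] a i ℚ.* shift i N (WM K)
      derivative = begin
        fromℕ (suc K) ℚ.* weightSum N (suc K) M
          ≡⟨ cong (fromℕ (suc K) ℚ.*_) (weightSum-by-multiplicity (suc K) N) ⟩
        fromℕ (suc K) ℚ.* Σ< (suc (suc K)) L
          ≡⟨ *-distribˡ-Σ (suc (suc K)) (fromℕ (suc K)) L ⟩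
        Σ[ t < suc (suc K) ] fromℕ (suc K) ℚ.* L t
          ≡⟨ Σ-cong (suc (suc K)) (λ t t<2+K → split t (ℕ.≤-pred t<2+K)) ⟩
        Σ[ t < suc (suc K) ] (fromℕ (suc K ∸ t) ℚ.* L t ℚ.+ fromℕ t ℚ.* L t)
          ≡⟨ Σ-+ (suc (suc K)) (λ t → fromℕ (suc K ∸ t) ℚ.* L t) (λ t → fromℕ t ℚ.* L t) ⟩
        Σ[ t < suc (suc K) ] fromℕ (suc K ∸ t) ℚ.* L t ℚ.+ Σ[ t < suc (suc K) ] fromℕ t ℚ.* L t
          ≡⟨ cong₂ ℚ._+_ fromBelow fromAbove ⟩
        Σ[ t < suc K ] (Σ[ i < suc m ] cross t i) ℚ.+ Σ[ t < suc K ] y ℚ.* shift M N (layer t K)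
          ≡⟨ expand ⟨
        Σ[ i < suc M ] a i ℚ.* shift i N (WM K) ∎
        where
        open ≡-Reasoning
        L : ℕ → ℚ
        L t = layer t (suc K) N
        split : ∀ t → t ≤ suc K → fromℕ (suc K) ℚ.* L t ≡ fromℕ (suc K ∸ t) ℚ.* L t ℚ.+ fromℕ t ℚ.* L t
        split t t≤1+K = begin
          fromℕ (suc K) ℚ.* L t                    ≡⟨ cong (λ n → fromℕ n ℚ.* L t) (ℕ.m∸n+n≡m t≤1+K) ⟨
          fromℕ (suc K ∸ t + t) ℚ.* L t            ≡⟨ cong (ℚ._* L t) (fromℕ-+ (suc K ∸ t) t) ⟩
          (fromℕ (suc K ∸ t) ℚ.+ fromℕ t) ℚ.* L t  ≡⟨ ℚ.*-distribʳ-+ (L t) (fromℕ (suc K ∸ t)) (fromℕ t) ⟩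
          fromℕ (suc K ∸ t) ℚ.* L t ℚ.+ fromℕ t ℚ.* L t ∎
        fromBelow : Σ[ t < suc (suc K) ] fromℕ (suc K ∸ t) ℚ.* L t ≡ Σ[ t < suc K ] (Σ[ i < suc m ] cross t i)
        fromBelow = begin
          Σ[ t < suc K ] fromℕ (suc K ∸ t) ℚ.* L t ℚ.+ fromℕ (suc K ∸ suc K) ℚ.* L (suc K)
            ≡⟨ cong (λ n → Σ[ t < suc K ] fromℕ (suc K ∸ t) ℚ.* L t ℚ.+ fromℕ n ℚ.* L (suc K)) (ℕ.n∸n≡0 K) ⟩
          Σ[ t < suc K ] fromℕ (suc K ∸ t) ℚ.* L t ℚ.+ 0ℚ ℚ.* L (suc K)
            ≡⟨ trans (cong (Σ[ t < suc K ] fromℕ (suc K ∸ t) ℚ.* L t ℚ.+_) (ℚ.*-zeroˡ (L (suc K))))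
                     (ℚ.+-identityʳ _) ⟩
          Σ[ t < suc K ] fromℕ (suc K ∸ t) ℚ.* L t
            ≡⟨ Σ-cong (suc K) (λ t t<1+K → lowered t (ℕ.≤-pred t<1+K)) ⟩
          Σ[ t < suc K ] (Σ[ i < suc m ] cross t i) ∎
        fromAbove : Σ[ t < suc (suc K) ] fromℕ t ℚ.* L t ≡ Σ[ t < suc K ] y ℚ.* shift M N (layer t K)
        fromAbove = begin
          Σ[ t < suc (suc K) ] fromℕ t ℚ.* L t
            ≡⟨ Σ-suc (suc K) (λ t → fromℕ t ℚ.* L t) ⟩
          0ℚ ℚ.* L 0 ℚ.+ Σ[ t < suc K ] fromℕ (suc t) ℚ.* L (suc t)
            ≡⟨ trans (cong (ℚ._+ (Σ[ t < suc K ] fromℕ (suc t) ℚ.* L (suc t))) (ℚ.*-zeroˡ (L 0)))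
                     (ℚ.+-identityˡ _) ⟩
          Σ[ t < suc K ] fromℕ (suc t) ℚ.* L (suc t)
            ≡⟨ Σ-cong (suc K) (λ t _ → raised t) ⟩
          Σ[ t < suc K ] y ℚ.* shift M N (layer t K) ∎

  weightSum-derivative : ∀ m → m ≤ B → Derivative m
  weightSum-derivative zero _ K N = begin
    fromℕ (suc K) ℚ.* weightSum N (suc K) 0
      ≡⟨ cong (fromℕ (suc K) ℚ.*_) (partSum-zero-bound N K (weight a B)) ⟩
    fromℕ (suc K) ℚ.* 0ℚ
      ≡⟨ ℚ.*-zeroʳ (fromℕ (suc K)) ⟩
    0ℚ
      ≡⟨ trans (ℚ.+-identityˡ _) (ℚ.*-zeroˡ (weightSum N K 0)) ⟨
    0ℚ ℚ.+ 0ℚ ℚ.* weightSum N K 0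
      ≡⟨ cong (λ a₀ → 0ℚ ℚ.+ a₀ ℚ.* weightSum N K 0) (a-even 0 refl) ⟨
    Σ[ i < 1 ] a i ℚ.* shift i N (λ N′ → weightSum N′ K 0) ∎
    where open ≡-Reasoning
  weightSum-derivative (suc m) 1+m≤B = byParity (suc m % 2 ≡ᵇ 1) refl
    where
    m≤B = ℕ.≤-trans (ℕ.n≤1+n m) 1+m≤B
    byParity : ∀ b → (suc m % 2 ≡ᵇ 1) ≡ b → Derivative (suc m)
    byParity true  odd  = LargestPart.DerivativeStep.derivative m 1+m≤B odd (weightSum-derivative m m≤B)
    byParity false even K N = begin
      fromℕ (suc K) ℚ.* weightSum N (suc K) (suc m)
        ≡⟨ cong (fromℕ (suc K) ℚ.*_) (sameBound (suc K) N) ⟩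
      fromℕ (suc K) ℚ.* weightSum N (suc K) m
        ≡⟨ weightSum-derivative m m≤B K N ⟩
      Σ[ i < suc m ] a i ℚ.* shift i N (λ N′ → weightSum N′ K m)
        ≡⟨ trans (cong₂ ℚ._+_ (Σ-cong (suc m) (λ i _ → cong (a i ℚ.*_) (shift-cong i N (sameBound K))))
                              topVanishes)
                 (ℚ.+-identityʳ _) ⟨
      Σ[ i < suc (suc m) ] a i ℚ.* shift i N (λ N′ → weightSum N′ K (suc m)) ∎
      where
      open ≡-Reasoning
      sameBound : ∀ K N → weightSum N K (suc m) ≡ weightSum N K m
      sameBound K N = partSum-even N K m (weight a B) even
      top = shift (suc m) N (λ N′ → weightSum N′ K (suc m))
      topVanishes : a (suc m) ℚ.* top ≡ 0ℚ
      topVanishes = trans (cong (ℚ._* top) (a-even (suc m) even)) (ℚ.*-zeroˡ top)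

  weightSum-power : ∀ K N → N ≤ B → weightSum N K N ℚ.* fromℕ (K !) ≡ powCoeff a K N
  weightSum-power zero zero _ = cong (λ w → (w ℚ.+ 0ℚ) ℚ.* 1ℚ) (weight-[] a B)
  weightSum-power zero (suc N) _ = ℚ.*-zeroˡ 1ℚ
  weightSum-power (suc K) N N≤B = begin
    weightSum N (suc K) N ℚ.* fromℕ (suc K ℕ.* K !)
      ≡⟨ cong (weightSum N (suc K) N ℚ.*_) (fromℕ-* (suc K) (K !)) ⟩
    weightSum N (suc K) N ℚ.* (fromℕ (suc K) ℚ.* fromℕ (K !))
      ≡⟨ regroup (weightSum N (suc K) N) (fromℕ (suc K)) (fromℕ (K !)) ⟩
    (fromℕ (suc K) ℚ.* weightSum N (suc K) N) ℚ.* fromℕ (K !)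
      ≡⟨ cong (ℚ._* fromℕ (K !)) (weightSum-derivative N N≤B K N) ⟩
    (Σ[ i < suc N ] a i ℚ.* shift i N (λ N′ → weightSum N′ K N)) ℚ.* fromℕ (K !)
      ≡⟨ *-distribʳ-Σ (suc N) (fromℕ (K !)) _ ⟩
    Σ[ i < suc N ] a i ℚ.* shift i N (λ N′ → weightSum N′ K N) ℚ.* fromℕ (K !)
      ≡⟨ Σ-cong (suc N) (λ i i<1+N → power-after i (ℕ.≤-pred i<1+N)) ⟩
    Σ[ i < suc N ] a i ℚ.* powCoeff a K (N ∸ i) ∎
    where
    open ≡-Reasoning
    regroup : ∀ w s f → w ℚ.* (s ℚ.* f) ≡ (s ℚ.* w) ℚ.* f
    regroup = solve 3 (λ w s f → w :* (s :* f) := (s :* w) :* f) refl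
    power-after : ∀ i → i ≤ N →
      a i ℚ.* shift i N (λ N′ → weightSum N′ K N) ℚ.* fromℕ (K !) ≡ a i ℚ.* powCoeff a K (N ∸ i)
    power-after i i≤N = begin
      a i ℚ.* shift i N (λ N′ → weightSum N′ K N) ℚ.* fromℕ (K !)
        ≡⟨ ℚ.*-assoc (a i) _ _ ⟩
      a i ℚ.* (shift i N (λ N′ → weightSum N′ K N) ℚ.* fromℕ (K !))
        ≡⟨ cong (λ w → a i ℚ.* (w ℚ.* fromℕ (K !))) (shift-≤ (λ N′ → weightSum N′ K N) i≤N) ⟩
      a i ℚ.* (weightSum (N ∸ i) K N ℚ.* fromℕ (K !))
        ≡⟨ cong (λ w → a i ℚ.* (w ℚ.* fromℕ (K !))) (partSum-bound (N ∸ i) K N (weight a B) (ℕ.m∸n≤m N i)) ⟩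
      a i ℚ.* (weightSum (N ∸ i) K (N ∸ i) ℚ.* fromℕ (K !))
        ≡⟨ cong (a i ℚ.*_) (weightSum-power K (N ∸ i) (ℕ.≤-trans (ℕ.m∸n≤m N i) N≤B)) ⟩
      a i ℚ.* powCoeff a K (N ∸ i) ∎

m!*n!∣[m+n]! : ∀ m n → m ! ℕ.* n ! ∣ (m + n) !
m!*n!∣[m+n]! m n = subst (λ k → m ! ℕ.* k ! ∣ (m + n) !) (ℕ.m+n∸m≡n m n) (k![n∸k]!∣n! (ℕ.m≤m+n m n))

[1+m]!^c*c!∣[c*[1+m]]! : ∀ m c → (suc m !) ℕ.^ c ℕ.* c ! ∣ (c ℕ.* suc m) !
[1+m]!^c*c!∣[c*[1+m]]! m zero    = ℕ.∣-refl
[1+m]!^c*c!∣[c*[1+m]]! m (suc c) = begin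
  (suc m !) ℕ.^ suc c ℕ.* suc c !
    ≡⟨ regroup m c (m !) ((suc m !) ℕ.^ c) (c !) ⟩
  ((suc m !) ℕ.^ c ℕ.* c ! ℕ.* m !) ℕ.* suc (m + c ℕ.* suc m)
    ∣⟨ ℕ.*-monoˡ-∣ _ (ℕ.*-monoˡ-∣ (m !) ([1+m]!^c*c!∣[c*[1+m]]! m c)) ⟩
  ((c ℕ.* suc m) ! ℕ.* m !) ℕ.* suc (m + c ℕ.* suc m)
    ∣⟨ ℕ.*-monoˡ-∣ _ (subst (_∣ (m + c ℕ.* suc m) !) (ℕ.*-comm (m !) _) (m!*n!∣[m+n]! m (c ℕ.* suc m))) ⟩
  (m + c ℕ.* suc m) ! ℕ.* suc (m + c ℕ.* suc m)
    ≡⟨ ℕ.*-comm ((m + c ℕ.* suc m) !) _ ⟩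
  (suc c ℕ.* suc m) ! ∎
  where
  open ℕ.∣-Reasoning
  regroup : ∀ m c F P C → ((1 + m) ℕ.* F ℕ.* P) ℕ.* ((1 + c) ℕ.* C) ≡ (P ℕ.* C ℕ.* F) ℕ.* ((1 + c) ℕ.* (1 + m))
  regroup = ℕ-Solver.solve-∀

sumℕ : ℕ → (ℕ → ℕ) → ℕ
sumℕ zero    f = 0
sumℕ (suc B) f = sumℕ B f + f (suc B)

∏[i!^cᵢ*cᵢ!]∣[Σi*cᵢ]! : ∀ B (c : ℕ → ℕ) →
  prodℕ B (λ i → (i !) ℕ.^ c i ℕ.* c i !) ∣ (sumℕ B (λ i → i ℕ.* c i)) !
∏[i!^cᵢ*cᵢ!]∣[Σi*cᵢ]! zero    c = ℕ.∣-refl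
∏[i!^cᵢ*cᵢ!]∣[Σi*cᵢ]! (suc B) c =
  ℕ.∣-trans (ℕ.*-pres-∣ (∏[i!^cᵢ*cᵢ!]∣[Σi*cᵢ]! B c) last)
            (m!*n!∣[m+n]! (sumℕ B (λ i → i ℕ.* c i)) (suc B ℕ.* c (suc B)))
  where
  last : (suc B !) ℕ.^ c (suc B) ℕ.* c (suc B) ! ∣ (suc B ℕ.* c (suc B)) !
  last = subst (λ k → (suc B !) ℕ.^ c (suc B) ℕ.* c (suc B) ! ∣ k !) (ℕ.*-comm (c (suc B)) (suc B))
               ([1+m]!^c*c!∣[c*[1+m]]! B (c (suc B)))

sumℕ-cong : ∀ B {f g : ℕ → ℕ} → (∀ i → i ≤ B → f i ≡ g i) → sumℕ B f ≡ sumℕ B g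
sumℕ-cong zero    eq = refl
sumℕ-cong (suc B) eq = cong₂ _+_ (sumℕ-cong B (λ i i≤B → eq i (ℕ.m≤n⇒m≤1+n i≤B))) (eq (suc B) ℕ.≤-refl)

sumℕ-update : ∀ B i {f g : ℕ → ℕ} e → 1 ≤ i → i ≤ B →
              (∀ j → j ≢ i → f j ≡ g j) → f i ≡ g i + e → sumℕ B f ≡ sumℕ B g + e
sumℕ-update zero    i e 1≤i i≤0 _ _ = ⊥-elim (ℕ.<⇒≱ 1≤i i≤0)
sumℕ-update (suc B) i {f} {g} e 1≤i i≤B off at with i ℕ.≟ suc B
... | yes refl = trans (cong₂ _+_ (sumℕ-cong B (λ j j≤B → off j (ℕ.<⇒≢ (s≤s j≤B)))) at)
                       (sym (ℕ.+-assoc (sumℕ B g) (g i) e))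
... | no i≢1+B = trans (cong₂ _+_ (sumℕ-update B i e 1≤i (ℕ.≤-pred (ℕ.≤∧≢⇒< i≤B i≢1+B)) off at)
                                  (off (suc B) (λ eq → i≢1+B (sym eq))))
                       (swap (sumℕ B g) e (g (suc B)))
  where
  swap : ∀ a b c → a + b + c ≡ a + c + b
  swap = ℕ-Solver.solve-∀

Σi*multᵢ≡sum : ∀ B ps → All (λ x → 1 ≤ x × x ≤ B) ps → sumℕ B (λ i → i ℕ.* mult ps i) ≡ sum ps
Σi*multᵢ≡sum zero    []       []                    = refl
Σi*multᵢ≡sum (suc B) []       []                    =
  cong₂ _+_ (Σi*multᵢ≡sum B [] []) (ℕ.*-zeroʳ (suc B))
Σi*multᵢ≡sum B (x ∷ ps) ((1≤x , x≤B) ∷ inRange) =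
  trans (sumℕ-update B x x 1≤x x≤B
           (λ j j≢x → cong (j ℕ.*_) (mult-∷-≢ {x} ps (λ x≡j → j≢x (sym x≡j))))
           (trans (cong (x ℕ.*_) (mult-∷-≡ x ps)) (trans (ℕ.*-suc x (mult ps x)) (ℕ.+-comm x _))))
        (trans (cong (_+ x) (Σi*multᵢ≡sum B ps inRange)) (ℕ.+-comm (sum ps) x))

denom∣N! : ∀ N ps → IsOddPartition N N ps → denom N ps ∣ N !
denom∣N! N ps (Σps≡N , oddParts) =
  subst (λ k → denom N ps ∣ k !)
        (trans (Σi*multᵢ≡sum N ps (All.map (λ (1≤x , x≤N , _) → 1≤x , x≤N) oddParts)) Σps≡N)
        (∏[i!^cᵢ*cᵢ!]∣[Σi*cᵢ]! N (mult ps))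

odd⇒[n∸1]/2≡n/2 : ∀ n → (n % 2 ≡ᵇ 1) ≡ true → (n ∸ 1) ℕ./ 2 ≡ n ℕ./ 2
odd⇒[n∸1]/2≡n/2 n odd = trans (cong (λ x → (x ∸ 1) ℕ./ 2) n≡1+[n/2]*2) (m*n/n≡m (n ℕ./ 2) 2)
  where
  n≡1+[n/2]*2 : n ≡ 1 + (n ℕ./ 2) ℕ.* 2
  n≡1+[n/2]*2 = trans (m≡m%n+[m/n]*n n 2)
    (cong (_+ (n ℕ./ 2) ℕ.* 2) (ℕ.≡ᵇ⇒≡ (n % 2) 1 (subst T (sym odd) tt)))

coeffF-odd : ∀ i → (i % 2 ≡ᵇ 1) ≡ true → coeffF i ≡ fromℤ (u ((i ∸ 1) ℕ./ 2)) ℚ.* (1/ℕ (i !)) {{i !≢0}}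
coeffF-odd i odd rewrite odd | odd⇒[n∸1]/2≡n/2 i odd = /≡fromℤ*1/ℕ (u (i ℕ./ 2)) (i !) {{i !≢0}}

coeffF-even : ∀ i → (i % 2 ≡ᵇ 1) ≡ false → coeffF i ≡ 0ℚ
coeffF-even i even rewrite even = refl

mult-even : ∀ {m} ps → All (OddPart m) ps → ∀ i → (i % 2 ≡ᵇ 1) ≡ false → mult ps i ≡ 0
mult-even []       []                   i even = refl
mult-even (x ∷ ps) ((_ , _ , odd) ∷ oddParts) i even =
  trans (mult-∷-≢ {x} ps (λ { refl → subst T (trans (sym odd) even) tt }))
        (mult-even ps oddParts i even)

uProd/denom≡weight : ∀ N ps → All (OddPart N) ps →
                     fromℤ (uProd N ps) ℚ.* (1/ℕ denom N ps) {{denom≢0 N ps}} ≡ weight coeffF N ps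
uProd/denom≡weight N ps oddParts = begin
  fromℤ (prodℤ N f) ℚ.* (1/ℕ prodℕ N g) {{prodℕ≢0 N g g≢0}}
    ≡⟨ cong₂ ℚ._*_ (fromℤ-prodℤ N f) (1/ℕ-prodℕ N g g≢0) ⟩
  prodℚ N (λ i → fromℤ (f i)) ℚ.* prodℚ N (λ i → (1/ℕ g i) {{g≢0 i}})
    ≡⟨ prodℚ-* N _ _ ⟩
  prodℚ N (λ i → fromℤ (f i) ℚ.* (1/ℕ g i) {{g≢0 i}})
    ≡⟨ prodℚ-cong N (λ i _ → factor i (i % 2 ≡ᵇ 1) refl) ⟩
  weight coeffF N ps ∎
  where
  open ≡-Reasoning
  f : ℕ → ℤ
  f i = u ((i ∸ 1) ℕ./ 2) ℤ.^ mult ps i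
  g : ℕ → ℕ
  g i = (i !) ℕ.^ mult ps i ℕ.* mult ps i !
  g≢0 : ∀ i → NonZero (g i)
  g≢0 i = ℕ.m*n≢0 _ _ {{ℕ.m^n≢0 (i !) (mult ps i) {{i !≢0}}}} {{mult ps i !≢0}}
  factor : ∀ i b → (i % 2 ≡ᵇ 1) ≡ b → fromℤ (f i) ℚ.* (1/ℕ g i) {{g≢0 i}} ≡ expCoeff (coeffF i) (mult ps i)
  factor i false even rewrite mult-even ps oddParts i even = refl
  factor i true  odd  = begin
    fromℤ (x ℤ.^ c) ℚ.* (1/ℕ ((i !) ℕ.^ c ℕ.* c !)) {{g≢0 i}}
      ≡⟨ cong₂ ℚ._*_ (fromℤ-^ x c)
           (trans (1/ℕ-* ((i !) ℕ.^ c) (c !) {{ℕ.m^n≢0 (i !) c {{i !≢0}}}} {{c !≢0}})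
                  (cong (ℚ._* (1/ℕ (c !)) {{c !≢0}}) (1/ℕ-^ (i !) c {{i !≢0}}))) ⟩
    fromℤ x ^ c ℚ.* (((1/ℕ (i !)) {{i !≢0}}) ^ c ℚ.* (1/ℕ (c !)) {{c !≢0}})
      ≡⟨ ℚ.*-assoc (fromℤ x ^ c) _ _ ⟨
    (fromℤ x ^ c ℚ.* ((1/ℕ (i !)) {{i !≢0}}) ^ c) ℚ.* (1/ℕ (c !)) {{c !≢0}}
      ≡⟨ cong (ℚ._* (1/ℕ (c !)) {{c !≢0}}) (^-distrib-* (fromℤ x) ((1/ℕ (i !)) {{i !≢0}}) c) ⟨
    (fromℤ x ℚ.* (1/ℕ (i !)) {{i !≢0}}) ^ c ℚ.* (1/ℕ (c !)) {{c !≢0}}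
      ≡⟨ cong (λ y → y ^ c ℚ.* (1/ℕ (c !)) {{c !≢0}}) (coeffF-odd i odd) ⟨
    expCoeff (coeffF i) c ∎
    where
    x = u ((i ∸ 1) ℕ./ 2)
    c = mult ps i

fromℤ-term : ∀ N ps → IsOddPartition N N ps → fromℤ (term N ps) ≡ fromℕ (N !) ℚ.* weight coeffF N ps
fromℤ-term N ps isPartition = begin
  fromℤ (+ multinom N ps ℤ.* uProd N ps)
    ≡⟨ fromℤ-* (+ multinom N ps) (uProd N ps) ⟩
  fromℕ (multinom N ps) ℚ.* fromℤ (uProd N ps)
    ≡⟨ cong (ℚ._* fromℤ (uProd N ps)) (fromℕ-/ (N !) (denom N ps) {{denom≢0 N ps}} (denom∣N! N ps isPartition)) ⟩
  fromℕ (N !) ℚ.* 1/ℕ′ ℚ.* fromℤ (uProd N ps)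
    ≡⟨ regroup (fromℕ (N !)) 1/ℕ′ (fromℤ (uProd N ps)) ⟩
  fromℕ (N !) ℚ.* (fromℤ (uProd N ps) ℚ.* 1/ℕ′)
    ≡⟨ cong (fromℕ (N !) ℚ.*_) (uProd/denom≡weight N ps (proj₂ isPartition)) ⟩
  fromℕ (N !) ℚ.* weight coeffF N ps ∎
  where
  open ≡-Reasoning
  1/ℕ′ = (1/ℕ denom N ps) {{denom≢0 N ps}}
  regroup : ∀ a b c → a ℚ.* b ℚ.* c ≡ a ℚ.* (c ℚ.* b)
  regroup = solve 3 (λ a b c → a :* b :* c := a :* (c :* b)) refl

s≡Σterm : ∀ n k → s n k ≡ fromℤ (sumListℤ (map (term (2 * n)) (P' (2 * n) (2 * k))))
s≡Σterm n k = begin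
  ((+ (N !)) / (K !)) {{K !≢0}} ℚ.* powCoeff coeffF K N
    ≡⟨ cong₂ ℚ._*_ (/≡fromℤ*1/ℕ (+ (N !)) (K !) {{K !≢0}}) (sym (weightSum-power K N ℕ.≤-refl)) ⟩
  (fromℕ (N !) ℚ.* 1/K!) ℚ.* (weightSum N K N ℚ.* fromℕ (K !))
    ≡⟨ regroup (fromℕ (N !)) 1/K! (weightSum N K N) (fromℕ (K !)) ⟩
  fromℕ (N !) ℚ.* weightSum N K N ℚ.* (fromℕ (K !) ℚ.* 1/K!)
    ≡⟨ trans (cong (fromℕ (N !) ℚ.* weightSum N K N ℚ.*_) (fromℕ*1/ℕ≡1 (K !) {{K !≢0}})) (ℚ.*-identityʳ _) ⟩
  fromℕ (N !) ℚ.* weightSum N K N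
    ≡⟨ *-distribˡ-partSum N K N (fromℕ (N !)) (weight coeffF N) ⟩
  partSum N K N (λ ps → fromℕ (N !) ℚ.* weight coeffF N ps)
    ≡⟨ partSum-cong N K N (λ ps isPartition → sym (fromℤ-term N ps isPartition)) ⟩
  partSum N K N (λ ps → fromℤ (term N ps))
    ≡⟨ fromℤ-sumListℤ (term N) (P' N K) ⟨
  fromℤ (sumListℤ (map (term N) (P' N K))) ∎
  where
  open ≡-Reasoning
  N = 2 * n
  K = 2 * k
  open OddSeries coeffF coeffF-even N using (weightSum; weightSum-power)
  1/K! = (1/ℕ (K !)) {{K !≢0}}
  regroup : ∀ a b c d → (a ℚ.* b) ℚ.* (c ℚ.* d) ≡ a ℚ.* c ℚ.* (d ℚ.* b)
  regroup = solve 4 (λ a b c d → (a :* b) :* (c :* d) := a :* c :* (d :* b)) refl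

corollary9 : (n k p : ℕ) → 1 ≤ k → k ≤ n → Prime p →
    ((ps : List ℕ) → ps ∈ P' (2 * n) (2 * k) → denom (2 * n) ps ∣ (2 * n) !)
    × (∃[ t ] ((s n k ≡ t / 1)
              × ((+ p) ℤD.∣ (t - sumListℤ (map (term (2 * n)) (P' (2 * n) (2 * k)))))))
corollary9 n k p _ _ _ =
  (λ ps ps∈P' → denom∣N! (2 * n) ps (All.lookup (oddPartsBounded-sound (2 * k) (2 * n) (2 * n)) ps∈P')) ,
  (Σterm , s≡Σterm n k , subst ((+ p) ℤD.∣_) (sym (ℤ.+-inverseʳ Σterm)) (p ℕ.∣0))
  where
  Σterm = sumListℤ (map (term (2 * n)) (P' (2 * n) (2 * k)))
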